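{- Let $A$ and $B$ be two nonzero $0,1$-matrices. Then $\mathrm{R}_{\mathbb{B}}(A\otimes B)\ge \mu(A)\cdot\mathrm{R}_{\mathbb{B}}(B)$.
   Context: The Boolean rank $\mathrm{R}_{\mathbb{B}}(A)$ of a $0,1$-matrix $A$ is the smallest number of all-ones combinatorial rectangles needed to cover all $1$-entries of $A$; a combinatorial rectangle is a set $X\times Y$ with $X$ a set of row indices and $Y$ a set of column indices, and it is monochromatic (all-ones) if all entries of $A$ in it equal $1$. For a nonzero $0,1$-matrix $A$, $\mu(A)$ is the number of $1$-entries of $A$ divided by the largest number of $1$-entries in a monochromatic all-ones combinatorial rectangle of $A$. The Kronecker product $A\otimes B$ is the block matrix whose $(i,j)$-th block is $A_{i,j}\cdot B$. -}

module Defs where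

open import Data.Nat using (ℕ; zero; suc; _+_; _*_; _≤_)
open import Data.Bool using (Bool; true; false; _∧_)
open import Data.Fin using (Fin; remQuot)
import Data.Fin as Fin
open import Data.Product using (Σ; ∃; _×_; _,_; proj₁; proj₂)
open import Relation.Binary.PropositionalEquality using (_≡_)

Matrix01 : ℕ → ℕ → Set
Matrix01 m n = Fin m → Fin n → Bool

countF : ∀ {n} → (Fin n → Bool) → ℕ
countF {zero}  f = 0
countF {suc n} f = (if' (f Fin.zero)) + countF (λ i → f (Fin.suc i))
  where
    if' : Bool → ℕ
    if' true  = 1
    if' false = 0

ones : ∀ {m n} → Matrix01 m n → ℕ
ones {m} {n} A = countF {m * n} (λ k → A (proj₁ (remQuot {m} n k)) (proj₂ (remQuot {m} n k)))

NonzeroM : ∀ {m n} → Matrix01 m n → Set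
NonzeroM {m} {n} A = Σ (Fin m) λ i → Σ (Fin n) λ j → A i j ≡ true

record Rect (m n : ℕ) : Set where
  constructor rect
  field
    rows : Fin m → Bool
    cols : Fin n → Bool
open Rect public

_∈R_ : ∀ {m n} → Fin m × Fin n → Rect m n → Set
(i , j) ∈R R = (rows R i ∧ cols R j) ≡ true

Mono : ∀ {m n} → Matrix01 m n → Rect m n → Set
Mono A R = ∀ i j → (i , j) ∈R R → A i j ≡ true

-- number of 1-entries of A inside R (= |X|·|Y| when R is monochromatic)
onesIn : ∀ {m n} → Matrix01 m n → Rect m n → ℕ
onesIn {m} {n} A R = ones {m} {n} (λ i j → A i j ∧ (rows R i ∧ cols R j))

Cover : ∀ {m n} → Matrix01 m n → ℕ → Set
Cover {m} {n} A k =
  Σ (Fin k → Rect m n) λ Rs →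
    (∀ t → Mono A (Rs t)) ×
    (∀ i j → A i j ≡ true → ∃ λ t → (i , j) ∈R Rs t)

IsBoolRank : ∀ {m n} → Matrix01 m n → ℕ → Set
IsBoolRank A r = Cover A r × (∀ k → Cover A k → r ≤ k)

IsMaxMonoRect : ∀ {m n} → Matrix01 m n → ℕ → Set
IsMaxMonoRect {m} {n} A s =
  (Σ (Rect m n) λ R → Mono A R × onesIn A R ≡ s) ×
  (∀ R → Mono A R → onesIn A R ≤ s)

-- Kronecker product: entry ((i₁,i₂),(j₁,j₂)) is A i₁ j₁ · B i₂ j₂,
-- with row index i₁ * m₂ + i₂ (i.e. Data.Fin.combine i₁ i₂).
_⊗_ : ∀ {m₁ n₁ m₂ n₂} → Matrix01 m₁ n₁ → Matrix01 m₂ n₂ → Matrix01 (m₁ * m₂) (n₁ * n₂)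
_⊗_ {m₁} {n₁} {m₂} {n₂} A B i j =
  A (proj₁ (remQuot {m₁} m₂ i)) (proj₁ (remQuot {n₁} n₂ j)) ∧ B (proj₂ (remQuot {m₁} m₂ i)) (proj₂ (remQuot {n₁} n₂ j))

-- Every rectangle X × Y of a cover of A ⊗ B projects to a monochromatic
-- rectangle of A, with at most s ones. For a 1-entry (a, b) of A, the
-- rectangles whose projection contains (a, b) meet the block (a, b) ≅ B in a
-- cover of B, so there are at least R(B) of them. Counting the incidences
-- between 1-entries of A and rectangles of the cover in both ways gives
-- ones A · R(B) ≤ R(A ⊗ B) · s.
module Submission where

open import Defs
open import Data.Nat using (ℕ; zero; suc; _*_; _≤_; z≤n)
open import Data.Nat.Properties using (+-mono-≤; ≤-trans; ≤-reflexive; m≤n+m; +-0-commutativeMonoid)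
open import Data.Bool using (Bool; true; false; _∧_; _≟_)
open import Data.Bool.Properties using (∧-conicalˡ; ∧-conicalʳ)
open import Data.Fin using (Fin; zero; suc; combine; remQuot)
open import Data.Fin.Properties using (any?; remQuot-combine)
open import Data.Product using (Σ; ∃-syntax; _×_; _,_; proj₁; proj₂)
open import Function using (_∘_)
open import Relation.Nullary using (Dec; yes; does)
open import Relation.Nullary.Decidable using (dec-true)
open import Relation.Binary.PropositionalEquality
open import Algebra.Properties.CommutativeMonoid.Sum +-0-commutativeMonoid using (sum; ∑-comm)

_∈ᵇ_ : ∀ {m n} → Fin m × Fin n → Rect m n → Bool
(i , j) ∈ᵇ R = rows R i ∧ cols R j

does-true : ∀ {p} {P : Set p} (P? : Dec P) → does P? ≡ true → P
does-true (yes p) _ = p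

anyᵇ : ∀ {n} → (Fin n → Bool) → Bool
anyᵇ p = does (any? λ i → p i ≟ true)

anyᵇ-intro : ∀ {n} (p : Fin n → Bool) i → p i ≡ true → anyᵇ p ≡ true
anyᵇ-intro p i pi = dec-true (any? λ i → p i ≟ true) (i , pi)

anyᵇ-elim : ∀ {n} (p : Fin n → Bool) → anyᵇ p ≡ true → ∃[ i ] p i ≡ true
anyᵇ-elim p = does-true (any? λ i → p i ≟ true)

∧-intro : ∀ {x y} → x ≡ true → y ≡ true → (x ∧ y) ≡ true
∧-intro refl refl = refl

∧-elimˡ : ∀ {x y} → (x ∧ y) ≡ true → x ≡ true
∧-elimˡ = ∧-conicalˡ _ _

∧-elimʳ : ∀ {x y} → (x ∧ y) ≡ true → y ≡ true
∧-elimʳ = ∧-conicalʳ _ _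

fromBool : Bool → ℕ
fromBool true  = 1
fromBool false = 0

countF≡sum : ∀ {n} (f : Fin n → Bool) → countF f ≡ sum (fromBool ∘ f)
countF≡sum {zero}  f = refl
countF≡sum {suc n} f with f zero
... | true  = cong suc (countF≡sum (f ∘ suc))
... | false = countF≡sum (f ∘ suc)

sum-≤-* : ∀ {n} (f : Fin n → ℕ) {c} → (∀ i → f i ≤ c) → sum f ≤ n * c
sum-≤-* {zero}  f f≤c = z≤n
sum-≤-* {suc n} f f≤c = +-mono-≤ (f≤c zero) (sum-≤-* (f ∘ suc) (f≤c ∘ suc))

countF-*-≤-sum : ∀ {n} (f : Fin n → Bool) (g : Fin n → ℕ) {c} →
                 (∀ i → f i ≡ true → c ≤ g i) → countF f * c ≤ sum g
countF-*-≤-sum {zero}  f g c≤g = z≤n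
countF-*-≤-sum {suc n} f g c≤g with f zero in fzero
... | true  = +-mono-≤ (c≤g zero fzero) (countF-*-≤-sum (f ∘ suc) (g ∘ suc) (c≤g ∘ suc))
... | false = ≤-trans (countF-*-≤-sum (f ∘ suc) (g ∘ suc) (c≤g ∘ suc)) (m≤n+m _ (g zero))

countF-double-counting : ∀ {n r} (f : Fin n → Bool) (g : Fin r → Fin n → Bool) {c s} →
  (∀ i → f i ≡ true → c ≤ countF (λ t → g t i)) →
  (∀ t → countF (λ i → f i ∧ g t i) ≤ s) →
  countF f * c ≤ r * s
countF-double-counting {n} {r} f g {c} {s} c≤count count≤s = begin
  countF f * c                                   ≤⟨ countF-*-≤-sum f column column≥c ⟩
  sum (λ i → sum (λ t → fromBool (f i ∧ g t i))) ≡⟨ ∑-comm (λ i t → fromBool (f i ∧ g t i)) ⟩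
  sum row                                        ≤⟨ sum-≤-* row row≤s ⟩
  r * s                                          ∎
  where
  open Data.Nat.Properties.≤-Reasoning
  column : Fin n → ℕ
  column i = sum (λ t → fromBool (f i ∧ g t i))
  row : Fin r → ℕ
  row t = sum (λ i → fromBool (f i ∧ g t i))
  column≥c : ∀ i → f i ≡ true → c ≤ column i
  column≥c i fi rewrite fi = ≤-trans (c≤count i fi) (≤-reflexive (countF≡sum (λ t → g t i)))
  row≤s : ∀ t → row t ≤ s
  row≤s t = ≤-trans (≤-reflexive (sym (countF≡sum (λ i → f i ∧ g t i)))) (count≤s t)

enumerateTrue : ∀ {n} (h : Fin n → Bool) →
  Σ (Fin (countF h) → Fin n) λ index → ∀ i → h i ≡ true → ∃[ k ] index k ≡ i
enumerateTrue {zero}  h = (λ ()) , (λ ())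
enumerateTrue {suc n} h with enumerateTrue (h ∘ suc) | h zero in hzero
... | index , index-onto | true = index′ , index′-onto
  where
  index′ : Fin (suc (countF (h ∘ suc))) → Fin (suc n)
  index′ zero    = zero
  index′ (suc k) = suc (index k)
  index′-onto : ∀ i → h i ≡ true → ∃[ k ] index′ k ≡ i
  index′-onto zero    _  = zero , refl
  index′-onto (suc i) hi with index-onto i hi
  ... | k , refl = suc k , refl
... | index , index-onto | false = suc ∘ index , index′-onto
  where
  index′-onto : ∀ i → h i ≡ true → ∃[ k ] suc (index k) ≡ i
  index′-onto zero    hi with () ← trans (sym hzero) hi
  index′-onto (suc i) hi with index-onto i hi
  ... | k , refl = k , refl

Cover-keep : ∀ {m n k} {A : Matrix01 m n} (Rs : Fin k → Rect m n) →
  (∀ t → Mono A (Rs t)) → (∀ i j → A i j ≡ true → ∃[ t ] (i , j) ∈R Rs t) →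
  (keep : Fin k → Bool) → (∀ t i j → (i , j) ∈R Rs t → keep t ≡ true) →
  Cover A (countF keep)
Cover-keep {A = A} Rs mono covers keep nonempty⇒kept
  with index , index-onto ← enumerateTrue keep =
  Rs ∘ index , mono ∘ index , covers′
  where
  covers′ : ∀ i j → A i j ≡ true → ∃[ k ] (i , j) ∈R Rs (index k)
  covers′ i j aij with covers i j aij
  ... | t , ij∈t with index-onto t (nonempty⇒kept t i j ij∈t)
  ... | k , refl = k , ij∈t

module _ {m₁ n₁ m₂ n₂ : ℕ} where

  ⊗-combine : (A : Matrix01 m₁ n₁) (B : Matrix01 m₂ n₂) → ∀ a i b j →
              (A ⊗ B) (combine a i) (combine b j) ≡ (A a b ∧ B i j)
  ⊗-combine A B a i b j =
    cong₂ (λ (a , i) (b , j) → A a b ∧ B i j) (remQuot-combine {m₁} {m₂} a i) (remQuot-combine {n₁} {n₂} b j)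

  projection : Rect (m₁ * m₂) (n₁ * n₂) → Rect m₁ n₁
  projection R = rect (λ a → anyᵇ λ i → rows R (combine a i)) (λ b → anyᵇ λ j → cols R (combine b j))

  block : Rect (m₁ * m₂) (n₁ * n₂) → Fin m₁ → Fin n₁ → Rect m₂ n₂
  block R a b = rect (λ i → rows R (combine a i)) (λ j → cols R (combine b j))

  block⇒projection : ∀ R {a b i j} → (i , j) ∈R block R a b → (a , b) ∈R projection R
  block⇒projection R {a} {b} {i} {j} ij∈ =
    ∧-intro (anyᵇ-intro _ i (∧-elimˡ ij∈)) (anyᵇ-intro _ j (∧-elimʳ ij∈))

  -- A point of the projection lifts to a point of R since R is a product X × Y.
  Mono-projection : ∀ {A B R} → Mono (A ⊗ B) R → Mono A (projection R)
  Mono-projection {A} {B} {R} mono a b ab∈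
    with i , ai∈ ← anyᵇ-elim _ (∧-elimˡ ab∈) | j , bj∈ ← anyᵇ-elim _ (∧-elimʳ ab∈) =
    ∧-elimˡ (trans (sym (⊗-combine A B a i b j)) (mono _ _ (∧-intro ai∈ bj∈)))

  Mono-block : ∀ {A B R} → Mono (A ⊗ B) R → ∀ a b → Mono B (block R a b)
  Mono-block {A} {B} {R} mono a b i j ij∈ =
    ∧-elimʳ {A a b} (trans (sym (⊗-combine A B a i b j)) (mono _ _ ij∈))

  Cover-block : ∀ {A B k} (Rs : Fin k → Rect (m₁ * m₂) (n₁ * n₂)) →
    (∀ t → Mono (A ⊗ B) (Rs t)) →
    (∀ i j → (A ⊗ B) i j ≡ true → ∃[ t ] (i , j) ∈R Rs t) →
    ∀ a b → A a b ≡ true → Cover B (countF λ t → (a , b) ∈ᵇ projection (Rs t))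
  Cover-block {A} {B} Rs mono covers a b aab =
    Cover-keep (λ t → block (Rs t) a b) (λ t → Mono-block {A} {B} {Rs t} (mono t) a b) covers-B
      (λ t → (a , b) ∈ᵇ projection (Rs t)) (λ t _ _ → block⇒projection (Rs t))
    where
    covers-B : ∀ i j → B i j ≡ true → ∃[ t ] (i , j) ∈R block (Rs t) a b
    covers-B i j bij = covers (combine a i) (combine b j) (trans (⊗-combine A B a i b j) (∧-intro aab bij))

-- NonzeroM A and NonzeroM B only make μ(A) well defined; the inequality
-- cleared of denominators holds without them.
theorem3 : ∀ {m₁ n₁ m₂ n₂} (A : Matrix01 m₁ n₁) (B : Matrix01 m₂ n₂) →
    NonzeroM A → NonzeroM B →
    ∀ (s rB rAB : ℕ) → IsMaxMonoRect A s → IsBoolRank B rB → IsBoolRank (A ⊗ B) rAB →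
    ones A * rB ≤ rAB * s
theorem3 {m₁} {n₁} A B _ _ s rB rAB (_ , s-max) (_ , rB-min) ((Rs , mono , covers) , _) =
  countF-double-counting (λ k → A (row k) (col k)) (λ t k → (row k , col k) ∈ᵇ projection (Rs t))
    (λ k ak → rB-min _ (Cover-block {A = A} Rs mono covers (row k) (col k) ak))
    (λ t → s-max (projection (Rs t)) (Mono-projection {A = A} {B = B} {R = Rs t} (mono t)))
  where
  row : Fin (m₁ * n₁) → Fin m₁
  row k = proj₁ (remQuot {m₁} n₁ k)
  col : Fin (m₁ * n₁) → Fin n₁
  col k = proj₂ (remQuot {m₁} n₁ k)
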